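{- For any PD-matching $M$ and any two job types $\tau_1,\tau_2$, there exists a PD-matching $M'$ with $|M'|=|M|$ such that at most one machine is matched in $M'$ both to a job of type $\tau_1$ and to a job of type $\tau_2$.
   Context: An instance consists of a set $U$ of jobs, a set $V$ of machines and nonnegative integer tolerances $b(j,i)$. A PD-matching is a set $M\subseteq U\times V$ such that every job belongs to at most one pair of $M$, and for every $(j,i)\in M$, $d_i(M)\le b(j,i)$, where $d_i(M)=|\{j:(j,i)\in M\}|$. Two jobs $j_1,j_2$ have the same type if $b(j_1,i)=b(j_2,i)$ for every machine $i$; a type is an equivalence class of jobs under this relation. -}

module Defs where

open import Data.Nat using (ℕ; _≤_)
open import Data.Fin using (Fin)
open import Data.Maybe using (Maybe; just; nothing)
open import Data.Product using (Σ; ∃; _×_)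
open import Relation.Binary.PropositionalEquality using (_≡_)
open import Data.Fin.Properties using (_≟_)
open import Relation.Nullary.Decidable using (does)
open import Data.Bool using (Bool; true; false; T)
open import Data.Bool.Properties using (T?)
open import Data.List using (List; length; filter)
open import Data.List.Base using (allFin)

-- An instance: n jobs (Fin n), m machines (Fin m), tolerances b(j,i).
Tolerance : ℕ → ℕ → Set
Tolerance n m = Fin n → Fin m → ℕ

-- A set M ⊆ U × V in which every job belongs to at most one pair is
-- exactly a partial assignment of jobs to machines.
Assignment : ℕ → ℕ → Set
Assignment n m = Fin n → Maybe (Fin m)

_↦_∈_ : ∀ {n m} → Fin n → Fin m → Assignment n m → Set
j ↦ i ∈ M = M j ≡ just i

isMatched : ∀ {m} → Maybe (Fin m) → Bool
isMatched (just _) = true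
isMatched nothing  = false

isAt : ∀ {m} → Fin m → Maybe (Fin m) → Bool
isAt i (just i') = does (i ≟ i')
isAt i nothing   = false

size : ∀ {n m} → Assignment n m → ℕ
size {n} M = length (filter (λ j → T? (isMatched (M j))) (allFin n))

load : ∀ {n m} → Assignment n m → Fin m → ℕ
load {n} M i = length (filter (λ j → T? (isAt i (M j))) (allFin n))

IsPDMatching : ∀ {n m} → Tolerance n m → Assignment n m → Set
IsPDMatching b M = ∀ j i → j ↦ i ∈ M → load M i ≤ b j i

SameType : ∀ {n m} → Tolerance n m → Fin n → Fin n → Set
SameType b j₁ j₂ = ∀ i → b j₁ i ≡ b j₂ i

-- machine i is matched in M to some job of the type of (representative) job t
MatchedToType : ∀ {n m} → Tolerance n m → Assignment n m → Fin n → Fin m → Set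
MatchedToType b M t i = ∃ λ j → SameType b j t × j ↦ i ∈ M

{-# OPTIONS --safe #-}
module Submission where

-- Rank the machines and let the potential of an assignment be the sum of the ranks of
-- the machines serving jobs of type t₁. If two machines i < i′ are both mixed, swap a
-- t₁-job on i with a t₂-job on i′: loads do not change, each moved job lands on a
-- machine that already served a job of its own type (so its tolerance suffices), and
-- the potential strictly grows. Being bounded, the potential can grow only finitely often.

open import Defs
open import Data.Nat using (ℕ)
open import Data.Fin using (Fin)
open import Data.Product using (Σ; _×_)
open import Relation.Binary.PropositionalEquality using (_≡_)
open import Relation.Nullary using (¬_)

open import Level using (Level)
open import Function using (_∘_; id)
open import Data.Bool using (Bool; true; false; if_then_else_)
open import Data.Bool.Properties using (T?)
open import Data.Nat using (zero; suc; _∸_; _<_; _≤_; z≤n)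
open import Data.Nat.Properties
  using (≤-refl; <⇒≤; +-mono-≤; +-mono-<-≤; +-mono-≤-<; ∸-monoʳ-<; module ≤-Reasoning)
open import Data.Nat.Induction using (<-wellFounded)
open import Induction.WellFounded using (Acc; acc)
import Data.Nat.Properties as ℕ
open import Data.Fin using (toℕ) renaming (zero to 0F; suc to 1+_; _<_ to _<ᶠ_)
open import Data.Fin.Properties using (_≟_; any?; all?; <-cmp; toℕ<n)
open import Data.Fin.Permutation using (Permutation′; _⟨$⟩ʳ_)
import Data.Fin.Permutation as Permutation
open import Data.Fin.Permutation.Components using (transpose)
open import Data.List using (length; filter; tabulate; allFin)
open import Data.Maybe using (Maybe; just; nothing)
import Data.Maybe.Properties as Maybe
open import Data.Product using (∃; ∃₂; _,_)
open import Data.Sum using (_⊎_; inj₁; inj₂)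
open import Relation.Binary using (tri<; tri≈; tri>)
open import Relation.Binary.PropositionalEquality using (refl; sym; trans; cong; subst; module ≡-Reasoning)
open import Relation.Nullary using (Dec; yes; no; does; _×-dec_; contradiction)
open import Relation.Nullary.Decidable using (dec-true; dec-false)
open import Algebra.Properties.CommutativeMonoid.Sum ℕ.+-0-commutativeMonoid
  using (sum; sum-permute)

private
  variable
    a p q : Level
    n m : ℕ

sum-mono-≤ : {f g : Fin n → ℕ} → (∀ j → f j ≤ g j) → sum f ≤ sum g
sum-mono-≤ {zero}  f≤g = z≤n
sum-mono-≤ {suc n} f≤g = +-mono-≤ (f≤g 0F) (sum-mono-≤ (f≤g ∘ 1+_))

sum-mono-< : {f g : Fin n → ℕ} → (∀ j → f j ≤ g j) → ∀ j → f j < g j → sum f < sum g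
sum-mono-< {suc n} f≤g 0F      f<g = +-mono-<-≤ f<g (sum-mono-≤ (f≤g ∘ 1+_))
sum-mono-< {suc n} f≤g (1+ j)  f<g = +-mono-≤-< (f≤g 0F) (sum-mono-< (f≤g ∘ 1+_) j f<g)

count-tabulate : {A : Set a} (P : A → Bool) (g : Fin n → A) →
  length (filter (T? ∘ P) (tabulate g)) ≡ sum (λ j → if P (g j) then 1 else 0)
count-tabulate {n = zero}  P g = refl
count-tabulate {n = suc n} P g with P (g 0F)
... | true  = cong suc (count-tabulate P (g ∘ 1+_))
... | false = count-tabulate P (g ∘ 1+_)

count-∘-permutation : ∀ {n} (P : Fin n → Bool) (π : Permutation′ n) →
  length (filter (T? ∘ P ∘ (π ⟨$⟩ʳ_)) (allFin n)) ≡ length (filter (T? ∘ P) (allFin n))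
count-∘-permutation {n} P π = begin
  length (filter (T? ∘ P ∘ (π ⟨$⟩ʳ_)) (allFin n)) ≡⟨ count-tabulate (P ∘ (π ⟨$⟩ʳ_)) id ⟩
  sum (λ j → if P (π ⟨$⟩ʳ j) then 1 else 0)       ≡⟨ sum-permute _ π ⟨
  sum (λ j → if P j then 1 else 0)                ≡⟨ count-tabulate P id ⟨
  length (filter (T? ∘ P) (allFin n))             ∎
  where open ≡-Reasoning

↦-functional : (M : Assignment n m) {j : Fin n} {i i′ : Fin m} →
  j ↦ i ∈ M → j ↦ i′ ∈ M → i ≡ i′
↦-functional M j↦i j↦i′ = Maybe.just-injective (trans (sym j↦i) j↦i′)

size-∘-permutation : (M : Assignment n m) (π : Permutation′ n) → size (M ∘ (π ⟨$⟩ʳ_)) ≡ size M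
size-∘-permutation M = count-∘-permutation (isMatched ∘ M)

load-∘-permutation : (M : Assignment n m) (π : Permutation′ n) (i : Fin m) →
  load (M ∘ (π ⟨$⟩ʳ_)) i ≡ load M i
load-∘-permutation M π i = count-∘-permutation (isAt i ∘ M) π

module _ {A : Set a} (Invariant : A → Set p) (Goal : A → Set q)
         (Φ : A → ℕ) (bound : ℕ) (Φ≤bound : ∀ x → Φ x ≤ bound)
         (improve : ∀ x → Invariant x → Goal x ⊎ ∃ λ y → Invariant y × Φ x < Φ y)
         where

  bounded-ascent : ∀ x → Invariant x → ∃ λ y → Invariant y × Goal y
  bounded-ascent x inv = climb x inv (<-wellFounded (bound ∸ Φ x))
    where
    climb : ∀ x → Invariant x → Acc _<_ (bound ∸ Φ x) → ∃ λ y → Invariant y × Goal y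
    climb x inv (acc rec) with improve x inv
    ... | inj₁ goal              = x , inv , goal
    ... | inj₂ (y , inv′ , Φx<Φy) = climb y inv′ (rec (∸-monoʳ-< Φx<Φy (Φ≤bound y)))

transpose-matchˡ : (j k : Fin n) → transpose j k j ≡ k
transpose-matchˡ j k rewrite dec-true (j ≟ j) refl = refl

transpose-cases : (j k l : Fin n) →
  (l ≡ j × transpose j k l ≡ k) ⊎ (l ≡ k × transpose j k l ≡ j) ⊎ transpose j k l ≡ l
transpose-cases j k l with l ≟ j
... | yes l≡j = inj₁ (l≡j , refl)
... | no _ with l ≟ k
...   | yes l≡k = inj₂ (inj₁ (l≡k , refl))
...   | no _    = inj₂ (inj₂ refl)

module _ {n m} (b : Tolerance n m) where

  sameType? : ∀ j t → Dec (SameType b j t)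
  sameType? j t = all? λ i → b j i ℕ.≟ b t i

  sameType-sym : ∀ {j t} → SameType b j t → SameType b t j
  sameType-sym j∼t i = sym (j∼t i)

  sameType-trans : ∀ {j k t} → SameType b j k → SameType b k t → SameType b j t
  sameType-trans j∼k k∼t i = trans (j∼k i) (k∼t i)

  matchedToType? : ∀ M t i → Dec (MatchedToType b M t i)
  matchedToType? M t i = any? λ j → sameType? j t ×-dec Maybe.≡-dec _≟_ (M j) (just i)

  matchedToType⇒load≤ : ∀ M {j i} → IsPDMatching b M → MatchedToType b M j i → load M i ≤ b j i
  matchedToType⇒load≤ M pd (k , k∼j , k↦i) = subst (_ ≤_) (k∼j _) (pd k _ k↦i)

  ∘-permutation-isPD : ∀ {M} → IsPDMatching b M → (π : Permutation′ n) →
    (∀ j i → (π ⟨$⟩ʳ j) ↦ i ∈ M → MatchedToType b M j i) →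
    IsPDMatching b (M ∘ (π ⟨$⟩ʳ_))
  ∘-permutation-isPD {M} pd π typed j i πj↦i =
    subst (_≤ b j i) (sym (load-∘-permutation M π i)) (matchedToType⇒load≤ M pd (typed j i πj↦i))

  transpose-isPD : ∀ {M j k i i′} → IsPDMatching b M → j ↦ i ∈ M → k ↦ i′ ∈ M →
    MatchedToType b M k i → MatchedToType b M j i′ →
    IsPDMatching b (M ∘ transpose j k)
  transpose-isPD {M} {j} {k} {i} {i′} pd j↦i k↦i′ k-at-i j-at-i′ =
    ∘-permutation-isPD pd (Permutation.transpose j k) typed
    where
    typed : ∀ l x → transpose j k l ↦ x ∈ M → MatchedToType b M l x
    typed l x tl↦x with transpose-cases j k l
    ... | inj₁ (refl , tl≡k) =
      subst (MatchedToType b M j) (↦-functional M k↦i′ (subst (_↦ x ∈ M) tl≡k tl↦x)) j-at-i′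
    ... | inj₂ (inj₁ (refl , tl≡j)) =
      subst (MatchedToType b M k) (↦-functional M j↦i (subst (_↦ x ∈ M) tl≡j tl↦x)) k-at-i
    ... | inj₂ (inj₂ tl≡l) = l , (λ _ → refl) , subst (_↦ x ∈ M) tl≡l tl↦x

  rank : Maybe (Fin m) → ℕ
  rank (just i) = toℕ i
  rank nothing  = 0

  rank≤ : ∀ x → rank x ≤ m
  rank≤ (just i) = <⇒≤ (toℕ<n i)
  rank≤ nothing  = z≤n

  module _ (t : Fin n) where

    weight : Fin n → Maybe (Fin m) → ℕ
    weight j x = if does (sameType? j t) then rank x else 0

    potential : Assignment n m → ℕ
    potential M = sum λ j → weight j (M j)

    weight-ofType : ∀ {j} x → SameType b j t → weight j x ≡ rank x
    weight-ofType {j} x j∼t rewrite dec-true (sameType? j t) j∼t = refl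

    weight-ofOtherType : ∀ {j} x → ¬ SameType b j t → weight j x ≡ 0
    weight-ofOtherType {j} x j≁t rewrite dec-false (sameType? j t) j≁t = refl

    weight≤ : ∀ j x → weight j x ≤ m
    weight≤ j x with does (sameType? j t)
    ... | true  = rank≤ x
    ... | false = z≤n

    potential≤ : ∀ M → potential M ≤ sum λ (_ : Fin n) → m
    potential≤ M = sum-mono-≤ λ j → weight≤ j (M j)

    potential-transpose-< : ∀ {M j k i i′} → SameType b j t → ¬ SameType b k t →
      j ↦ i ∈ M → k ↦ i′ ∈ M → i <ᶠ i′ → potential M < potential (M ∘ transpose j k)
    potential-transpose-< {M} {j} {k} {i} {i′} j∼t k≁t j↦i k↦i′ i<i′ =
      sum-mono-< moved-≤ j
        (subst (λ l → weight j (M j) < weight j (M l)) (sym (transpose-matchˡ j k)) gain)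
      where
      open ≤-Reasoning
      gain : weight j (M j) < weight j (M k)
      gain = begin-strict
        weight j (M j) ≡⟨ weight-ofType (M j) j∼t ⟩
        rank (M j)     ≡⟨ cong rank j↦i ⟩
        toℕ i          <⟨ i<i′ ⟩
        toℕ i′         ≡⟨ cong rank k↦i′ ⟨
        rank (M k)     ≡⟨ weight-ofType (M k) j∼t ⟨
        weight j (M k) ∎
      moved-≤ : ∀ l → weight l (M l) ≤ weight l (M (transpose j k l))
      moved-≤ l with transpose-cases j k l
      ... | inj₁ (refl , tl≡k)     rewrite tl≡k = <⇒≤ gain
      ... | inj₂ (inj₁ (refl , _)) rewrite weight-ofOtherType (M k) k≁t = z≤n
      ... | inj₂ (inj₂ tl≡l)       rewrite tl≡l = ≤-refl

  module _ (t₁ t₂ : Fin n) where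

    Mixed : Assignment n m → Fin m → Set
    Mixed M i = MatchedToType b M t₁ i × MatchedToType b M t₂ i

    TwoMixed : Assignment n m → Set
    TwoMixed M = ∃₂ λ i i′ → Mixed M i × Mixed M i′ × i <ᶠ i′

    AtMostOneMixed : Assignment n m → Set
    AtMostOneMixed M = ∀ i i′ → MatchedToType b M t₁ i → MatchedToType b M t₂ i →
      MatchedToType b M t₁ i′ → MatchedToType b M t₂ i′ → i ≡ i′

    mixed? : ∀ M i → Dec (Mixed M i)
    mixed? M i = matchedToType? M t₁ i ×-dec matchedToType? M t₂ i

    twoMixed? : ∀ M → Dec (TwoMixed M)
    twoMixed? M = any? λ i → any? λ i′ → mixed? M i ×-dec mixed? M i′ ×-dec toℕ i ℕ.<? toℕ i′

    ¬twoMixed⇒atMostOneMixed : ∀ {M} → ¬ TwoMixed M → AtMostOneMixed M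
    ¬twoMixed⇒atMostOneMixed ¬two i i′ i∼t₁ i∼t₂ i′∼t₁ i′∼t₂ with <-cmp i i′
    ... | tri< i<i′ _ _ = contradiction (i , i′ , (i∼t₁ , i∼t₂) , (i′∼t₁ , i′∼t₂) , i<i′) ¬two
    ... | tri≈ _ i≡i′ _ = i≡i′
    ... | tri> _ _ i′<i = contradiction (i′ , i , (i′∼t₁ , i′∼t₂) , (i∼t₁ , i∼t₂) , i′<i) ¬two

    untangle : ¬ SameType b t₁ t₂ → ∀ {M} → IsPDMatching b M → TwoMixed M →
      ∃ λ M′ → IsPDMatching b M′ × size M′ ≡ size M × potential t₁ M < potential t₁ M′
    untangle t₁≁t₂ {M} pd (i , i′ , ((j₁ , j₁∼t₁ , j₁↦i) , (j₂ , j₂∼t₂ , j₂↦i))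
                                   , ((k₁ , k₁∼t₁ , k₁↦i′) , (k₂ , k₂∼t₂ , k₂↦i′)) , i<i′) =
        M ∘ transpose j₁ k₂
      , transpose-isPD pd j₁↦i k₂↦i′ (j₂ , sameType-trans j₂∼t₂ (sameType-sym k₂∼t₂) , j₂↦i)
                                     (k₁ , sameType-trans k₁∼t₁ (sameType-sym j₁∼t₁) , k₁↦i′)
      , size-∘-permutation M (Permutation.transpose j₁ k₂)
      , potential-transpose-< t₁ j₁∼t₁ k₂≁t₁ j₁↦i k₂↦i′ i<i′
      where
      k₂≁t₁ : ¬ SameType b k₂ t₁
      k₂≁t₁ k₂∼t₁ = t₁≁t₂ (sameType-trans (sameType-sym k₂∼t₁) k₂∼t₂)

claim8 : ∀ {n m} (b : Tolerance n m) (M : Assignment n m) → IsPDMatching b M →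
    (t₁ t₂ : Fin n) → ¬ SameType b t₁ t₂ →
    Σ (Assignment n m) λ M′ → IsPDMatching b M′ × size M′ ≡ size M ×
      (∀ i i′ → MatchedToType b M′ t₁ i → MatchedToType b M′ t₂ i →
        MatchedToType b M′ t₁ i′ → MatchedToType b M′ t₂ i′ → i ≡ i′)
claim8 {n} {m} b M pd t₁ t₂ t₁≁t₂ =
  let M′ , (pd′ , size≡) , atMostOne = bounded-ascent Invariant (AtMostOneMixed b t₁ t₂)
                                         (potential b t₁) _ (potential≤ b t₁) improve M (pd , refl)
  in M′ , pd′ , size≡ , atMostOne
  where
  Invariant : Assignment n m → Set
  Invariant M′ = IsPDMatching b M′ × size M′ ≡ size M

  improve : ∀ M′ → Invariant M′ →
    AtMostOneMixed b t₁ t₂ M′ ⊎ ∃ λ M″ → Invariant M″ × potential b t₁ M′ < potential b t₁ M″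
  improve M′ (pd′ , size≡) with twoMixed? b t₁ t₂ M′
  ... | no ¬two = inj₁ (¬twoMixed⇒atMostOneMixed b t₁ t₂ ¬two)
  ... | yes two =
    let M″ , pd″ , size≡′ , gain = untangle b t₁ t₂ t₁≁t₂ pd′ two
    in inj₂ (M″ , (pd″ , trans size≡′ size≡) , gain)
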